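{- Let $n\ge 1$ and $k>n$ be integers, and let $Y$ be the set of vectors in $[k]^n$ with pairwise distinct entries. Consider the following adversarial process. Set $R_0=Y$. For $m=1,2,\dots$, the codebreaker submits an arbitrary query $x^m\in[k]^n$ (entries may repeat; $x^m$ may depend arbitrarily on previous queries and answers); the codemaker answers with $b_m:=\min_{\sigma\in R_{m-1}}\mathrm{black}(\sigma,x^m)$, chooses some $y^m\in R_{m-1}$ with $\mathrm{black}(y^m,x^m)=b_m$, and sets $R_m:=\{\sigma\in Y:\ \mathrm{black}(\sigma,x^j)=\mathrm{black}(y^j,x^j)\text{ for all } j\in[m]\}$. Then $b_m<n$ for all $m<k$.
   Context: $[k]=\{1,\dots,k\}$. For $x,y\in[k]^n$, $\mathrm{black}(x,y)=|\{i\in[n]: x(i)=y(i)\}|$. -}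

module Defs where

open import Data.Nat using (ℕ; zero; suc; _+_; _≤_; _<_; _∸_)
open import Data.Fin using (Fin; _≟_)
import Data.Fin as F
open import Data.Product using (Σ; _×_; ∃-syntax)
open import Relation.Binary.PropositionalEquality using (_≡_)
open import Relation.Nullary using (yes; no)
open import Function.Definitions using (Injective)

Word : ℕ → ℕ → Set
Word n k = Fin n → Fin k

black : ∀ {n k} → Word n k → Word n k → ℕ
black {zero}  x y = 0
black {suc n} x y with x F.zero ≟ y F.zero
... | yes _ = suc (black (λ i → x (F.suc i)) (λ i → y (F.suc i)))
... | no  _ = black (λ i → x (F.suc i)) (λ i → y (F.suc i))

InY : ∀ {n k} → Word n k → Set
InY σ = Injective _≡_ _≡_ σ

-- R_m for the play given by queries x and codemaker choices y (indexed from 1):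
-- σ ∈ Y and black(σ, x^j) = black(y^j, x^j) for all j ∈ [m].
InR : ∀ {n k} → (ℕ → Word n k) → (ℕ → Word n k) → ℕ → Word n k → Set
InR x y m σ = InY σ × (∀ j → 1 ≤ j → j ≤ m → black σ (x j) ≡ black (y j) (x j))

ValidRound : ∀ {n k} → (ℕ → Word n k) → (ℕ → Word n k) → ℕ → Set
ValidRound x y j =
  InR x y (j ∸ 1) (y j) × (∀ σ → InR x y (j ∸ 1) σ → black (y j) (x j) ≤ black σ (x j))

IsAnswer : ∀ {n k} → (ℕ → Word n k) → (ℕ → Word n k) → ℕ → ℕ → Set
IsAnswer x y m b =
  (∃[ σ ] (InR x y (m ∸ 1) σ × black σ (x m) ≡ b))
  × (∀ σ → InR x y (m ∸ 1) σ → b ≤ black σ (x m))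

-- Let σ ∈ R_{m-1} attain b = b_m. Since m < k, every position i has a colour a(i) differing from
-- σ(i) and from x^1(i), …, x^{m-1}(i). Replacing σ by a on a suitable nonempty set S of positions
-- (one position whose new colour is unused by σ, or else an orbit of the map sending i to the
-- position where σ shows colour a(i)) gives a code τ ∈ Y with τ ≠ σ. On every earlier query τ
-- scores at most as many blacks as σ, and the codemaker's minimal choices then force τ ∈ R_{m-1}.
-- At the position where τ and σ differ, one of them misses x^m, so b < n.
module Submission where

open import Defs
open import Data.Nat using (ℕ; zero; suc; _+_; _∸_; _≤_; _<_; z≤n; s≤s; s≤s⁻¹)
open import Data.Nat.Properties
  using (m≤n⇒m≤1+n; m≤n⇒m<n∨m≡n; ≤-refl; ≤-trans; ≤-antisym; ≤-reflexive; ≤-<-trans;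
         <⇒≤; <-irrefl; n<1+n; +-comm; +-suc; +-∸-assoc; m∸n+n≡m)
open import Data.Nat.GeneralisedArithmetic using (fold; fold-+)
open import Data.Fin using (Fin; toℕ; fromℕ<; _≟_) renaming (zero to fzero; suc to fsuc)
open import Data.Fin.Properties using (any?; all?; ¬∀⟶∃¬; pigeonhole; toℕ-fromℕ<; toℕ<n)
open import Data.Product using (_,_; proj₁; proj₂; ∃; ∃₂)
open import Data.Sum using (_⊎_; inj₁; inj₂)
open import Data.Empty using (⊥-elim)
open import Level using (Level)
open import Relation.Nullary using (¬_; yes; no)
open import Relation.Unary using (Pred; Decidable)
open import Relation.Binary.PropositionalEquality
  using (_≡_; _≢_; refl; sym; trans; cong; subst; module ≡-Reasoning)
open import Function.Definitions using (Injective)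

private
  variable
    n k : ℕ

black≤n : (σ τ : Word n k) → black σ τ ≤ n
black≤n {zero}  σ τ = z≤n
black≤n {suc n} σ τ with σ fzero ≟ τ fzero
... | yes _ = s≤s (black≤n _ _)
... | no  _ = m≤n⇒m≤1+n (black≤n _ _)

black<n : (σ τ : Word n k) (i : Fin n) → σ i ≢ τ i → black σ τ < n
black<n {suc n} σ τ fzero σ≢τ with σ fzero ≟ τ fzero
... | yes σ≡τ = ⊥-elim (σ≢τ σ≡τ)
... | no  _   = s≤s (black≤n _ _)
black<n {suc n} σ τ (fsuc i) σ≢τ with σ fzero ≟ τ fzero
... | yes _ = s≤s (black<n _ _ i σ≢τ)
... | no  _ = m≤n⇒m≤1+n (black<n _ _ i σ≢τ)

black-mono : (σ τ z : Word n k) → (∀ i → τ i ≡ z i → σ i ≡ z i) → black τ z ≤ black σ z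
black-mono {zero}  _ _ _ _ = z≤n
black-mono {suc n} σ τ z τ⇒σ with τ fzero ≟ z fzero | σ fzero ≟ z fzero
... | yes _   | yes _   = s≤s (black-mono _ _ _ (λ i → τ⇒σ (fsuc i)))
... | yes τ≡z | no  σ≢z = ⊥-elim (σ≢z (τ⇒σ fzero τ≡z))
... | no  _   | yes _   = m≤n⇒m≤1+n (black-mono _ _ _ (λ i → τ⇒σ (fsuc i)))
... | no  _   | no  _   = black-mono _ _ _ (λ i → τ⇒σ (fsuc i))

black<n-⊎ : (σ τ z : Word n k) (i : Fin n) → τ i ≢ σ i → black σ z < n ⊎ black τ z < n
black<n-⊎ σ τ z i τ≢σ with σ i ≟ z i
... | yes σ≡z = inj₂ (black<n τ z i (λ τ≡z → τ≢σ (trans τ≡z (sym σ≡z))))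
... | no  σ≢z = inj₁ (black<n σ z i σ≢z)

∃-fresh-colour : ∀ {m} → m < k → (g : Fin m → Fin k) → ∃ λ c → ∀ t → g t ≢ c
∃-fresh-colour {k} m<k g with ¬∀⟶∃¬ k _ (λ c → any? (λ t → g t ≟ c)) all-hit
  where
  all-hit : ¬ (∀ c → ∃ λ t → g t ≡ c)
  all-hit hit with pigeonhole m<k (λ c → proj₁ (hit c))
  ... | i , j , i<j , same = <-irrefl (cong toℕ i≡j) i<j
    where
    i≡j : i ≡ j
    i≡j = trans (sym (proj₂ (hit i))) (trans (cong g same) (proj₂ (hit j)))
... | c , unhit = c , λ t g≡c → unhit (t , g≡c)

∃-fresh-word : ∀ {m} → m < k → (w : Fin m → Word n k) → ∃ λ (a : Word n k) → ∀ t i → w t i ≢ a i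
∃-fresh-word m<k w = (λ i → proj₁ (fresh i)) , λ t i → proj₂ (fresh i) t
  where
  fresh : ∀ i → ∃ λ c → ∀ t → w t i ≢ c
  fresh i = ∃-fresh-colour m<k (λ t → w t i)

periodic-point : (f : Fin n → Fin n) → Fin n → ∃₂ λ c q → fold c f (suc q) ≡ c
periodic-point {n} f z with pigeonhole (n<1+n n) (λ (r : Fin (suc n)) → fold z f (toℕ r))
... | r , t , r<t , same = fold z f s , toℕ t ∸ suc s , periodic
  where
  s : ℕ
  s = toℕ r
  open ≡-Reasoning
  periodic : fold (fold z f s) f (suc (toℕ t ∸ suc s)) ≡ fold z f s
  periodic = begin
    fold (fold z f s) f (suc (toℕ t ∸ suc s)) ≡⟨ fold-+ z f (suc (toℕ t ∸ suc s)) ⟨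
    fold z f (suc (toℕ t ∸ suc s) + s)        ≡⟨ cong (λ u → fold z f (u + s)) (+-∸-assoc 1 r<t) ⟨
    fold z f (toℕ t ∸ s + s)                  ≡⟨ cong (fold z f) (m∸n+n≡m (<⇒≤ r<t)) ⟩
    fold z f (toℕ t)                          ≡⟨ same ⟨
    fold z f s                                ∎

module Orbit (f : Fin n → Fin n) (c : Fin n) (q : ℕ) (periodic : fold c f (suc q) ≡ c) where

  Orbit : Pred (Fin n) Level.zero
  Orbit i = ∃ λ (r : Fin (suc q)) → fold c f (toℕ r) ≡ i

  orbit? : Decidable Orbit
  orbit? i = any? (λ r → fold c f (toℕ r) ≟ i)

  c∈orbit : Orbit c
  c∈orbit = fzero , refl

  orbit-closed : ∀ {i} → Orbit i → Orbit (f i)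
  orbit-closed (r , refl) with m≤n⇒m<n∨m≡n (s≤s⁻¹ (toℕ<n r))
  ... | inj₁ r<q  = fsuc (fromℕ< r<q) , cong (λ u → f (fold c f u)) (toℕ-fromℕ< r<q)
  ... | inj₂ r≡q  = fzero , sym (trans (cong (λ u → fold c f (suc u)) r≡q) periodic)

  orbit-return : ∀ {i} → Orbit i → fold (f i) f q ≡ i
  orbit-return (r , refl) = begin
    fold (fold c f (suc (toℕ r))) f q ≡⟨ fold-+ c f q ⟨
    fold c f (q + suc (toℕ r))        ≡⟨ cong (fold c f) (trans (+-comm q (suc (toℕ r))) (sym (+-suc (toℕ r) q))) ⟩
    fold c f (toℕ r + suc q)          ≡⟨ fold-+ c f (toℕ r) ⟩
    fold (fold c f (suc q)) f (toℕ r) ≡⟨ cong (λ u → fold u f (toℕ r)) periodic ⟩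
    fold c f (toℕ r)                  ∎
    where open ≡-Reasoning

  orbit-injective : ∀ {i j} → Orbit i → Orbit j → f i ≡ f j → i ≡ j
  orbit-injective i∈ j∈ fi≡fj =
    trans (sym (orbit-return i∈)) (trans (cong (λ u → fold u f q) fi≡fj) (orbit-return j∈))

record Variant (σ a : Word n k) : Set where
  field
    word      : Word n k
    injective : Injective _≡_ _≡_ word
    from-σ-a  : ∀ i → word i ≡ σ i ⊎ word i ≡ a i
    moved     : Fin n
    moves     : word moved ≢ σ moved

module Variants (σ a : Word n k) (σ-injective : Injective _≡_ _≡_ σ) (a≢σ : ∀ i → a i ≢ σ i) where

  module Patch {ℓ} {S : Pred (Fin n) ℓ} (S? : Decidable S) where

    patch : Word n k
    patch i with S? i
    ... | yes _ = a i
    ... | no  _ = σ i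

    patch-injective : (∀ {i j} → S i → S j → a i ≡ a j → i ≡ j)
                    → (∀ {i j} → S i → ¬ S j → a i ≢ σ j)
                    → Injective _≡_ _≡_ patch
    patch-injective a-inj disjoint {i} {j} same with S? i | S? j
    ... | yes i∈ | yes j∈ = a-inj i∈ j∈ same
    ... | yes i∈ | no  j∉ = ⊥-elim (disjoint i∈ j∉ same)
    ... | no  i∉ | yes j∈ = ⊥-elim (disjoint j∈ i∉ (sym same))
    ... | no  _  | no  _  = σ-injective same

    patch-from-σ-a : ∀ i → patch i ≡ σ i ⊎ patch i ≡ a i
    patch-from-σ-a i with S? i
    ... | yes _ = inj₂ refl
    ... | no  _ = inj₁ refl

    patch-moves : ∀ {i} → S i → patch i ≢ σ i
    patch-moves {i} i∈ with S? i
    ... | yes _  = a≢σ i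
    ... | no  i∉ = ⊥-elim (i∉ i∈)

    patch-variant : ∀ {c} → S c
                  → (∀ {i j} → S i → S j → a i ≡ a j → i ≡ j)
                  → (∀ {i j} → S i → ¬ S j → a i ≢ σ j)
                  → Variant σ a
    patch-variant {c} c∈ a-inj disjoint = record
      { word = patch ; injective = patch-injective a-inj disjoint
      ; from-σ-a = patch-from-σ-a ; moved = c ; moves = patch-moves c∈ }

  variant-fresh : ∀ i₀ → (∀ j → σ j ≢ a i₀) → Variant σ a
  variant-fresh i₀ fresh =
    Patch.patch-variant (_≟ i₀) refl (λ { refl refl _ → refl }) (λ { refl _ a≡σ → fresh _ (sym a≡σ) })

  variant-orbit : (f : Fin n → Fin n) → (∀ i → σ (f i) ≡ a i) → Fin n → Variant σ a
  variant-orbit f σf≡a z with periodic-point f z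
  ... | c , q , periodic =
    Patch.patch-variant orbit? c∈orbit
      (λ i∈ j∈ a≡a → orbit-injective i∈ j∈ (σ-injective (trans (σf≡a _) (trans a≡a (sym (σf≡a _))))))
      (λ i∈ j∉ a≡σ → j∉ (subst Orbit (σ-injective (trans (σf≡a _) a≡σ)) (orbit-closed i∈)))
    where open Orbit f c q periodic

  variant : 1 ≤ n → Variant σ a
  variant 0<n with all? (λ i → any? (λ j → σ j ≟ a i))
  ... | yes hit = variant-orbit (λ i → proj₁ (hit i)) (λ i → proj₂ (hit i)) (fromℕ< 0<n)
  ... | no  ¬hit with ¬∀⟶∃¬ n _ (λ i → any? (λ j → σ j ≟ a i)) ¬hit
  ...   | i₀ , unhit = variant-fresh i₀ (λ j σ≡a → unhit (j , σ≡a))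

-- Because each y^j minimises black(·, x^j) over R_{j-1}, any code of Y scoring no more blacks
-- than a survivor on every past query also survives.
survives : (x y : ℕ → Word n k) (r : ℕ) → (∀ j → 1 ≤ j → j ≤ r → ValidRound x y j)
         → ∀ {σ τ} → InR x y r σ → InY τ
         → (∀ j → 1 ≤ j → j ≤ r → black τ (x j) ≤ black σ (x j))
         → InR x y r τ
survives x y zero _ _ τ∈Y _ = τ∈Y , λ { _ (s≤s _) () }
survives x y (suc r) valid {σ} {τ} (σ∈Y , σ-agrees) τ∈Y τ≤σ = τ∈Y , τ-agrees
  where
  τ∈R : InR x y r τ
  τ∈R = survives x y r (λ j 1≤j j≤r → valid j 1≤j (m≤n⇒m≤1+n j≤r))
          (σ∈Y , λ j 1≤j j≤r → σ-agrees j 1≤j (m≤n⇒m≤1+n j≤r)) τ∈Y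
          (λ j 1≤j j≤r → τ≤σ j 1≤j (m≤n⇒m≤1+n j≤r))
  τ-agrees : ∀ j → 1 ≤ j → j ≤ suc r → black τ (x j) ≡ black (y j) (x j)
  τ-agrees j 1≤j j≤1+r with m≤n⇒m<n∨m≡n j≤1+r
  ... | inj₁ (s≤s j≤r) = proj₂ τ∈R j 1≤j j≤r
  ... | inj₂ refl      = ≤-antisym (≤-trans (τ≤σ j 1≤j ≤-refl) (≤-reflexive (σ-agrees j 1≤j ≤-refl)))
                                   (proj₂ (valid j 1≤j ≤-refl) τ τ∈R)

lemma3 : (n k : ℕ) → 1 ≤ n → n < k
    → (x y : ℕ → Word n k)
    → (m : ℕ) → 1 ≤ m → m < k
    → (∀ j → 1 ≤ j → j < m → ValidRound x y j)
    → (b : ℕ) → IsAnswer x y m b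
    → b < n
lemma3 n k 1≤n _ x y (suc m) _ m<k valid b ((σ , σ∈R , σ-attains) , b-minimal) =
  conclude (black<n-⊎ σ τ (x (suc m)) (Variant.moved V) (Variant.moves V))
  where
  past : Fin (suc m) → Word n k
  past fzero    = σ
  past (fsuc t) = x (suc (toℕ t))
  a : Word n k
  a = proj₁ (∃-fresh-word m<k past)
  a-fresh : ∀ t i → past t i ≢ a i
  a-fresh = proj₂ (∃-fresh-word m<k past)
  V : Variant σ a
  V = Variants.variant σ a (proj₁ σ∈R) (λ i a≡σ → a-fresh fzero i (sym a≡σ)) 1≤n
  τ : Word n k
  τ = Variant.word V
  τ⇒σ : ∀ j → 1 ≤ j → j ≤ m → ∀ i → τ i ≡ x j i → σ i ≡ x j i
  τ⇒σ (suc j) _ j<m i τ≡x with Variant.from-σ-a V i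
  ... | inj₁ τ≡σ = trans (sym τ≡σ) τ≡x
  ... | inj₂ τ≡a = ⊥-elim (a-fresh (fsuc (fromℕ< j<m)) i
                     (trans (cong (λ u → x (suc u) i) (toℕ-fromℕ< j<m)) (trans (sym τ≡x) τ≡a)))
  τ∈R : InR x y m τ
  τ∈R = survives x y m (λ j 1≤j j≤m → valid j 1≤j (s≤s j≤m)) σ∈R (Variant.injective V)
          (λ j 1≤j j≤m → black-mono σ τ (x j) (τ⇒σ j 1≤j j≤m))
  conclude : black σ (x (suc m)) < n ⊎ black τ (x (suc m)) < n → b < n
  conclude (inj₁ σ-misses) = subst (_< n) σ-attains σ-misses
  conclude (inj₂ τ-misses) = ≤-<-trans (b-minimal τ τ∈R) τ-misses
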